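{- Let $\varphi$ be a pattern of sort $s$ and $y$ a variable of sort $s$ with $y\notin FV(\varphi)$. For every model $M$ satisfying the definedness axioms, $\varphi$ is functional in $M$ iff $M\models\exists y.(\varphi=y)$. Consequently, for a set of patterns $F$ containing the definedness axioms, $\varphi$ is functional in $F$ iff $F\models\exists y.(\varphi=y)$.
   Context: Matching logic over a many-sorted signature containing definedness symbols $\lceil\_\rceil_{s_1}^{s_2}$ with axioms $\lceil x{:}s_1\rceil_{s_1}^{s_2}$. Models: nonempty carriers, $\sigma_M:M_{s_1}\times\cdots\times M_{s_n}\to\mathcal P(M_s)$ extended to sets by union; $\bar\rho(x)=\{\rho(x)\}$, symbols pointwise, $\neg$ complement, $\wedge$ intersection, $\exists$ union. $M\models\psi$ iff $\bar\rho(\psi)$ is the whole carrier for all $\rho$; $F\models\psi$ iff all models of $F$ satisfy $\psi$. $\lfloor\psi\rfloor\equiv\neg\lceil\neg\psi\rceil$, $\psi=\psi'\equiv\lfloor\psi\leftrightarrow\psi'\rfloor$. A pattern $\varphi$ is functional in $M$ iff $|\bar\rho(\varphi)|=1$ for every valuation $\rho$; functional in $F$ iff functional in every model of $F$. -}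

module Defs where

open import Level using (0ℓ)
open import Data.Nat using (ℕ; _≟_)
open import Data.List using (List; []; _∷_)
open import Data.List.Relation.Unary.All using (All; []; _∷_)
open import Data.Product using (Σ; ∃; _×_; _,_)
open import Data.Unit using (⊤)
open import Relation.Nullary using (¬_; yes; no)
open import Relation.Binary.Definitions using (DecidableEquality)
open import Relation.Binary.PropositionalEquality using (_≡_; refl)

record Signature : Set₁ where
  field
    Sort     : Set
    _≟S_     : DecidableEquality Sort
    Sym      : List Sort → Sort → Set
    definedness : (s₁ s₂ : Sort) → Sym (s₁ ∷ []) s₂

module ML (Sig : Signature) where
  open Signature Sig

  -- Patterns of sort s.  The variable  var x  of sort s is  x:s.
  data Pattern : Sort → Set where
    var  : ∀ {s} → ℕ → Pattern s
    app  : ∀ {ss s} → Sym ss s → All Pattern ss → Pattern s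
    ¬ₚ_  : ∀ {s} → Pattern s → Pattern s
    _∧ₚ_ : ∀ {s} → Pattern s → Pattern s → Pattern s
    ∃ₚ   : ∀ {s} (s' : Sort) (x : ℕ) → Pattern s → Pattern s

  mutual
    data FreeIn (s' : Sort) (x : ℕ) : ∀ {s} → Pattern s → Set where
      fv-var : FreeIn s' x {s'} (var x)
      fv-app : ∀ {ss s} {σ : Sym ss s} {ps} → FreeInArgs s' x ps → FreeIn s' x (app σ ps)
      fv-¬   : ∀ {s} {p : Pattern s} → FreeIn s' x p → FreeIn s' x (¬ₚ p)
      fv-∧ˡ  : ∀ {s} {p q : Pattern s} → FreeIn s' x p → FreeIn s' x (p ∧ₚ q)
      fv-∧ʳ  : ∀ {s} {p q : Pattern s} → FreeIn s' x q → FreeIn s' x (p ∧ₚ q)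
      fv-∃   : ∀ {s} {t z} {p : Pattern s} → ¬ (t ≡ s' × z ≡ x) → FreeIn s' x p → FreeIn s' x (∃ₚ t z p)
    data FreeInArgs (s' : Sort) (x : ℕ) : ∀ {ss} → All Pattern ss → Set where
      here  : ∀ {s ss} {p : Pattern s} {ps : All Pattern ss} → FreeIn s' x p → FreeInArgs s' x (p ∷ ps)
      there : ∀ {s ss} {p : Pattern s} {ps : All Pattern ss} → FreeInArgs s' x ps → FreeInArgs s' x (p ∷ ps)

  _∨ₚ_ : ∀ {s} → Pattern s → Pattern s → Pattern s
  p ∨ₚ q = ¬ₚ ((¬ₚ p) ∧ₚ (¬ₚ q))

  _→ₚ_ : ∀ {s} → Pattern s → Pattern s → Pattern s
  p →ₚ q = (¬ₚ p) ∨ₚ q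

  _↔ₚ_ : ∀ {s} → Pattern s → Pattern s → Pattern s
  p ↔ₚ q = (p →ₚ q) ∧ₚ (q →ₚ p)

  ⌈_⌉[_] : ∀ {s₁} → Pattern s₁ → (s₂ : Sort) → Pattern s₂
  ⌈_⌉[_] {s₁} p s₂ = app (definedness s₁ s₂) (p ∷ [])

  ⌊_⌋[_] : ∀ {s₁} → Pattern s₁ → (s₂ : Sort) → Pattern s₂
  ⌊ p ⌋[ s₂ ] = ¬ₚ ⌈ ¬ₚ p ⌉[ s₂ ]

  _=ₚ[_]_ : ∀ {s₁} → Pattern s₁ → (s₂ : Sort) → Pattern s₁ → Pattern s₂
  p =ₚ[ s₂ ] q = ⌊ p ↔ₚ q ⌋[ s₂ ]

  definednessAxiom : (s₁ s₂ : Sort) → Pattern s₂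
  definednessAxiom s₁ s₂ = ⌈ var {s₁} 0 ⌉[ s₂ ]

  -- Models: nonempty carriers, σ_M : M_{s1} × … × M_{sn} → P(M_s),
  -- subsets represented as predicates.
  record Model : Set₁ where
    field
      Carrier  : Sort → Set
      nonempty : (s : Sort) → Carrier s
      interp   : ∀ {ss s} → Sym ss s → All Carrier ss → Carrier s → Set

  module _ (M : Model) where
    open Model M

    Valuation : Set
    Valuation = (s : Sort) → ℕ → Carrier s

    update : Valuation → (s : Sort) → ℕ → Carrier s → Valuation
    update ρ s x a s' x' with s ≟S s' | x ≟ x'
    ... | yes refl | yes _ = a
    ... | _        | _     = ρ s' x'

    mutual
      ⟦_⟧ : ∀ {s} → Pattern s → Valuation → Carrier s → Set
      ⟦ var {s} x ⟧ ρ b = b ≡ ρ s x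
      ⟦ app σ ps ⟧ ρ b = Σ (All Carrier _) λ as → ⟦ ps ⟧* ρ as × interp σ as b
      ⟦ ¬ₚ p ⟧ ρ b = ¬ ⟦ p ⟧ ρ b
      ⟦ p ∧ₚ q ⟧ ρ b = ⟦ p ⟧ ρ b × ⟦ q ⟧ ρ b
      ⟦ ∃ₚ s' x p ⟧ ρ b = Σ (Carrier s') λ a → ⟦ p ⟧ (update ρ s' x a) b

      ⟦_⟧* : ∀ {ss} → All Pattern ss → Valuation → All Carrier ss → Set
      ⟦ [] ⟧* ρ [] = ⊤
      ⟦ p ∷ ps ⟧* ρ (a ∷ as) = ⟦ p ⟧ ρ a × ⟦ ps ⟧* ρ as

    Satisfies : ∀ {s} → Pattern s → Set
    Satisfies {s} ψ = (ρ : Valuation) (b : Carrier s) → ⟦ ψ ⟧ ρ b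

    IsSingleton : ∀ {s} → (Carrier s → Set) → Set
    IsSingleton {s} P = Σ (Carrier s) λ a → P a × ((b : Carrier s) → P b → b ≡ a)

    FunctionalIn : ∀ {s} → Pattern s → Set
    FunctionalIn φ = (ρ : Valuation) → IsSingleton (⟦ φ ⟧ ρ)

  _⊨_ : ∀ {s} → Model → Pattern s → Set
  M ⊨ ψ = Satisfies M ψ

  SatisfiesDefinedness : Model → Set
  SatisfiesDefinedness M = (s₁ s₂ : Sort) → M ⊨ definednessAxiom s₁ s₂

  PatternSet : Set₁
  PatternSet = (s : Sort) → Pattern s → Set

  ContainsDefinedness : PatternSet → Set
  ContainsDefinedness F = (s₁ s₂ : Sort) → F s₂ (definednessAxiom s₁ s₂)

  ModelOf : Model → PatternSet → Set
  ModelOf M F = (s : Sort) (ψ : Pattern s) → F s ψ → M ⊨ ψ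

  _⊨ᶠ_ : ∀ {s} → PatternSet → Pattern s → Set₁
  F ⊨ᶠ ψ = (M : Model) → ModelOf M F → M ⊨ ψ

  FunctionalInTheory : ∀ {s} → PatternSet → Pattern s → Set₁
  FunctionalInTheory F φ = (M : Model) → ModelOf M F → FunctionalIn M φ

-- Under the definedness axioms, ⌈ψ⌉ holds (everywhere) iff ψ is nonempty, so ⌊ψ⌋ holds iff ψ is
-- the whole carrier and  φ = y  holds at ρ iff ρ̄(φ) = {ρ(y)}.  As y is not free in φ, changing
-- ρ(y) does not change ρ̄(φ); hence ∃y. φ = y  holds at ρ iff ρ̄(φ) is a singleton.  Reading a
-- complement of a complement as the original set needs excluded middle.
module Submission where

open import Defs
open import Level using (0ℓ)
open import Data.Nat using (ℕ; _≟_)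
open import Data.Product using (_×_; _,_; proj₁; proj₂)
open import Data.List.Relation.Unary.All using (All; []; _∷_)
open import Data.Unit using (tt)
open import Data.Empty using (⊥-elim)
open import Relation.Nullary using (¬_; yes; no)
open import Relation.Binary.PropositionalEquality using (_≡_; refl; sym; trans; subst)
open import Function.Bundles using (_⇔_; mk⇔; module Equivalence)
open import Axiom.ExcludedMiddle using (ExcludedMiddle)
open import Axiom.DoubleNegationElimination using (DoubleNegationElimination; em⇒dne)

module Semantics (Sig : Signature) where
  open Signature Sig
  open ML Sig
  open Equivalence using (to; from)

  module _ (M : Model) where
    open Model M

    update-same : ∀ (ρ : Valuation M) s x a → update M ρ s x a s x ≡ a
    update-same ρ s x a with s ≟S s | x ≟ x
    ... | yes refl | yes _  = refl
    ... | yes refl | no x≢x = ⊥-elim (x≢x refl)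
    ... | no s≢s   | _      = ⊥-elim (s≢s refl)

    update-other : ∀ (ρ : Valuation M) s x a s' x' → ¬ (s ≡ s' × x ≡ x') →
                   update M ρ s x a s' x' ≡ ρ s' x'
    update-other ρ s x a s' x' ≢ with s ≟S s' | x ≟ x'
    ... | yes refl | yes x≡x' = ⊥-elim (≢ (refl , x≡x'))
    ... | yes refl | no _     = refl
    ... | no _     | _        = refl

    update-cong : ∀ (ρ ρ' : Valuation M) s x a s' x' →
                  (¬ (s ≡ s' × x ≡ x') → ρ s' x' ≡ ρ' s' x') →
                  update M ρ s x a s' x' ≡ update M ρ' s x a s' x'
    update-cong ρ ρ' s x a s' x' agree with s ≟S s' | x ≟ x'
    ... | yes refl | yes _    = refl
    ... | yes refl | no x≢x'  = agree (λ eq → x≢x' (proj₂ eq))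
    ... | no s≢s'  | _        = agree (λ eq → s≢s' (proj₁ eq))

    mutual
      ⟦⟧-coincidence : ∀ {s} (p : Pattern s) (ρ ρ' : Valuation M) →
                       (∀ s' x → FreeIn s' x p → ρ s' x ≡ ρ' s' x) →
                       ∀ b → ⟦_⟧ M p ρ b → ⟦_⟧ M p ρ' b
      ⟦⟧-coincidence (var x) ρ ρ' agree b b≡ρx = trans b≡ρx (agree _ x fv-var)
      ⟦⟧-coincidence (app σ ps) ρ ρ' agree b (as , ps∋as , σas∋b) =
        as , ⟦⟧*-coincidence ps ρ ρ' (λ s' x fv → agree s' x (fv-app fv)) as ps∋as , σas∋b
      ⟦⟧-coincidence (¬ₚ p) ρ ρ' agree b ∉p ∈p =
        ∉p (⟦⟧-coincidence p ρ' ρ (λ s' x fv → sym (agree s' x (fv-¬ fv))) b ∈p)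
      ⟦⟧-coincidence (p ∧ₚ q) ρ ρ' agree b (∈p , ∈q) =
        ⟦⟧-coincidence p ρ ρ' (λ s' x fv → agree s' x (fv-∧ˡ fv)) b ∈p ,
        ⟦⟧-coincidence q ρ ρ' (λ s' x fv → agree s' x (fv-∧ʳ fv)) b ∈q
      ⟦⟧-coincidence (∃ₚ t z p) ρ ρ' agree b (a , ∈p) =
        a , ⟦⟧-coincidence p (update M ρ t z a) (update M ρ' t z a)
              (λ s' x fv → update-cong ρ ρ' t z a s' x (λ bound → agree s' x (fv-∃ bound fv))) b ∈p

      ⟦⟧*-coincidence : ∀ {ss} (ps : All Pattern ss) (ρ ρ' : Valuation M) →
                        (∀ s' x → FreeInArgs s' x ps → ρ s' x ≡ ρ' s' x) →
                        ∀ as → ⟦_⟧* M ps ρ as → ⟦_⟧* M ps ρ' as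
      ⟦⟧*-coincidence [] ρ ρ' agree [] tt = tt
      ⟦⟧*-coincidence (p ∷ ps) ρ ρ' agree (a ∷ as) (∈p , ∈ps) =
        ⟦⟧-coincidence p ρ ρ' (λ s' x fv → agree s' x (here fv)) a ∈p ,
        ⟦⟧*-coincidence ps ρ ρ' (λ s' x fv → agree s' x (there fv)) as ∈ps

    ⟦⟧-update-fresh : ∀ {s} {φ : Pattern s} {y} → ¬ FreeIn s y φ → ∀ ρ c a →
                      ⟦_⟧ M φ (update M ρ s y c) a ⇔ ⟦_⟧ M φ ρ a
    ⟦⟧-update-fresh {s} {φ} {y} y∉φ ρ c a =
      mk⇔ (⟦⟧-coincidence φ (update M ρ s y c) ρ update-agrees a)
          (⟦⟧-coincidence φ ρ (update M ρ s y c) (λ s' x fv → sym (update-agrees s' x fv)) a)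
      where
      update-agrees : ∀ s' x → FreeIn s' x φ → update M ρ s y c s' x ≡ ρ s' x
      update-agrees s' x fv = update-other ρ s y c s' x λ { (refl , refl) → y∉φ fv }

    →ₚ-intro : ∀ {s} {p q : Pattern s} {ρ a} →
               (⟦_⟧ M p ρ a → ⟦_⟧ M q ρ a) → ⟦_⟧ M (p →ₚ q) ρ a
    →ₚ-intro p⇒q (¬¬p , ¬q) = ¬¬p (λ ∈p → ¬q (p⇒q ∈p))

    →ₚ-elim : DoubleNegationElimination 0ℓ → ∀ {s} {p q : Pattern s} {ρ a} →
              ⟦_⟧ M (p →ₚ q) ρ a → ⟦_⟧ M p ρ a → ⟦_⟧ M q ρ a
    →ₚ-elim dne p→q ∈p = dne (λ ∉q → p→q ((λ ∉p → ∉p ∈p) , ∉q))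

    ⌊⌋-intro : ∀ {s} {p : Pattern s} {ρ} s₂ {b} → (∀ a → ⟦_⟧ M p ρ a) → ⟦_⟧ M ⌊ p ⌋[ s₂ ] ρ b
    ⌊⌋-intro s₂ ∀p ((a ∷ []) , (∉p , tt) , _) = ∉p (∀p a)

    definedness-total : SatisfiesDefinedness M → ∀ s₁ s₂ a b →
                        interp (definedness s₁ s₂) (a ∷ []) b
    definedness-total D s₁ s₂ a b with D s₁ s₂ (update M (λ s _ → nonempty s) s₁ 0 a) b
    ... | (a' ∷ []) , (a'≡ρ0 , tt) , ⌈a'⌉∋b =
      subst (λ a → interp (definedness s₁ s₂) (a ∷ []) b)
            (trans a'≡ρ0 (update-same _ s₁ 0 a)) ⌈a'⌉∋b

    ⌊⌋-elim : DoubleNegationElimination 0ℓ → SatisfiesDefinedness M →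
              ∀ {s} {p : Pattern s} {ρ} s₂ {b} → ⟦_⟧ M ⌊ p ⌋[ s₂ ] ρ b → ∀ a → ⟦_⟧ M p ρ a
    ⌊⌋-elim dne D {s} s₂ {b} ⌊p⌋ a =
      dne (λ ∉p → ⌊p⌋ ((a ∷ []) , (∉p , tt) , definedness-total D s s₂ a b))

    =ₚ-intro : ∀ {s} {p q : Pattern s} {ρ} s₂ {b} →
               (∀ a → ⟦_⟧ M p ρ a ⇔ ⟦_⟧ M q ρ a) → ⟦_⟧ M (p =ₚ[ s₂ ] q) ρ b
    =ₚ-intro s₂ p⇔q = ⌊⌋-intro s₂ λ a → →ₚ-intro (to (p⇔q a)) , →ₚ-intro (from (p⇔q a))

    =ₚ-elim : DoubleNegationElimination 0ℓ → SatisfiesDefinedness M →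
              ∀ {s} {p q : Pattern s} {ρ} s₂ {b} →
              ⟦_⟧ M (p =ₚ[ s₂ ] q) ρ b → ∀ a → ⟦_⟧ M p ρ a ⇔ ⟦_⟧ M q ρ a
    =ₚ-elim dne D s₂ p=q a with ⌊⌋-elim dne D s₂ p=q a
    ... | p→q , q→p = mk⇔ (→ₚ-elim dne p→q) (→ₚ-elim dne q→p)

    module _ {s} {φ : Pattern s} {y : ℕ} (y∉φ : ¬ FreeIn s y φ) (s₂ : Sort) where

      functional⇒⊨∃= : FunctionalIn M φ → M ⊨ ∃ₚ s y (φ =ₚ[ s₂ ] var y)
      functional⇒⊨∃= functional ρ b with functional ρ
      ... | c , c∈φ , unique = c , =ₚ-intro s₂ λ a →
        mk⇔ (λ a∈φ → trans (unique a (to (fresh a) a∈φ)) (sym ρ'y≡c))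
            (λ a≡ρ'y → from (fresh a) (subst (⟦_⟧ M φ ρ) (sym (trans a≡ρ'y ρ'y≡c)) c∈φ))
        where
        fresh : ∀ a → ⟦_⟧ M φ (update M ρ s y c) a ⇔ ⟦_⟧ M φ ρ a
        fresh = ⟦⟧-update-fresh y∉φ ρ c
        ρ'y≡c : update M ρ s y c s y ≡ c
        ρ'y≡c = update-same ρ s y c

      ⊨∃=⇒functional : DoubleNegationElimination 0ℓ → SatisfiesDefinedness M →
                       M ⊨ ∃ₚ s y (φ =ₚ[ s₂ ] var y) → FunctionalIn M φ
      ⊨∃=⇒functional dne D ⊨∃= ρ with ⊨∃= ρ (nonempty s₂)
      ... | c , φ=y = c , from (φ⇔c c) refl , λ a → to (φ⇔c a)
        where
        φ⇔c : ∀ a → ⟦_⟧ M φ ρ a ⇔ a ≡ c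
        φ⇔c a = mk⇔
          (λ a∈φ → trans (to (=ₚ-elim dne D s₂ φ=y a) (from (fresh a) a∈φ)) ρ'y≡c)
          (λ a≡c → to (fresh a) (from (=ₚ-elim dne D s₂ φ=y a) (trans a≡c (sym ρ'y≡c))))
          where
          fresh : ∀ a → ⟦_⟧ M φ (update M ρ s y c) a ⇔ ⟦_⟧ M φ ρ a
          fresh = ⟦⟧-update-fresh y∉φ ρ c
          ρ'y≡c : update M ρ s y c s y ≡ c
          ρ'y≡c = update-same ρ s y c

  modelOf⇒satisfiesDefinedness : ∀ {F M} → ContainsDefinedness F → ModelOf M F →
                                 SatisfiesDefinedness M
  modelOf⇒satisfiesDefinedness F∋def M⊨F s₁ s₂ =
    M⊨F s₂ (definednessAxiom s₁ s₂) (F∋def s₁ s₂)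

proposition5p18 : ExcludedMiddle 0ℓ → (Sig : Signature) →
    let open Signature Sig in
    let open ML Sig in
    {s : Sort} (φ : Pattern s) (y : ℕ) → ¬ FreeIn s y φ → (s₂ : Sort) →
      ((M : Model) → SatisfiesDefinedness M →
        (FunctionalIn M φ ⇔ (M ⊨ ∃ₚ s y (φ =ₚ[ s₂ ] var y))))
      × ((F : PatternSet) → ContainsDefinedness F →
        (FunctionalInTheory F φ ⇔ (F ⊨ᶠ ∃ₚ s y (φ =ₚ[ s₂ ] var y))))
proposition5p18 em Sig φ y y∉φ s₂ =
  (λ M D → mk⇔ (functional⇒⊨∃= M y∉φ s₂) (⊨∃=⇒functional M y∉φ s₂ dne D)) ,
  (λ F F∋def → mk⇔
    (λ functional M M⊨F → functional⇒⊨∃= M y∉φ s₂ (functional M M⊨F))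
    (λ F⊨∃= M M⊨F → ⊨∃=⇒functional M y∉φ s₂ dne
                      (modelOf⇒satisfiesDefinedness F∋def M⊨F) (F⊨∃= M M⊨F)))
  where
  open Semantics Sig
  dne : DoubleNegationElimination 0ℓ
  dne = em⇒dne em
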